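{- Let $(\ell,c)$ be a letter realisation of a graph $G$ over a decoder $D=(\Sigma,A)$, and let $a,b\in\Sigma$ be two distinct letters that interlace in $w(\ell,c)$. Let $V_a=\ell^{ -1}(a)$ and $V_b=\ell^{ -1}(b)$. Then $a$ and $b$ are independent in $D$ if and only if the bipartite graph $G[V_a,V_b]$ is homogeneous (complete bipartite or edgeless).
   Context: A decoder is a directed graph $D=(\Sigma,A)$ (loops allowed) on a finite alphabet. An $n$-vertex graph $G=(V,E)$ has letter realisation $(\ell,c)$ over $D$, with $\ell:V\to\Sigma$ and $c:V\to[n]$ a bijection, if two distinct vertices $x,y$ are adjacent iff either $(\ell(x),\ell(y))\in A$ and $c(x)<c(y)$, or $(\ell(y),\ell(x))\in A$ and $c(y)<c(x)$. The word $w(\ell,c)=w_1\cdots w_n$ has $w_i=\ell(c^{ -1}(i))$. Two distinct letters $a,b$ are dependent in $D$ if exactly one of $(a,b),(b,a)$ is in $A$, and independent otherwise. For a word $w$ and distinct letters $a,b$, $\mathrm{inter}_w(a,b)$ is the largest $t$ such that $w$ contains as a (not necessarily contiguous) subword the $t$-fold concatenation of $ab$; $a$ and $b$ interlace in $w$ if $w$ contains $abab$ or $baba$ as a subword. $G[X,Y]$ denotes the bipartite graph on disjoint $X\cup Y$ with the edges of $G$ between $X$ and $Y$. -}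

module Defs where

open import Data.Nat using (ℕ)
open import Data.Fin using (Fin; _<_)
open import Data.Bool using (Bool; true; false; T)
open import Data.Product using (_×_; ∃-syntax; _,_)
open import Data.Sum using (_⊎_)
open import Relation.Nullary using (¬_)
open import Relation.Binary.PropositionalEquality using (_≡_)
open import Function.Bundles using (_↔_; Inverse; _⇔_)

record Decoder (k : ℕ) : Set where
  field
    arc : Fin k → Fin k → Bool

open Decoder public

record Graph (n : ℕ) : Set₁ where
  field
    Adj     : Fin n → Fin n → Set
    symm    : ∀ {x y} → Adj x y → Adj y x
    irrefl  : ∀ x → ¬ Adj x x

open Graph public

record LetterRealisation {n k : ℕ} (D : Decoder k) (G : Graph n) : Set₁ where
  field
    ℓ : Fin n → Fin k
    c : Fin n ↔ Fin n
    adjacency : ∀ x y → ¬ (x ≡ y) →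
      (Adj G x y ⇔
        ((T (arc D (ℓ x) (ℓ y)) × Inverse.to c x < Inverse.to c y)
         ⊎ (T (arc D (ℓ y) (ℓ x)) × Inverse.to c y < Inverse.to c x)))

word : ∀ {n k} {D : Decoder k} {G : Graph n} → LetterRealisation D G → Fin n → Fin k
word R i = LetterRealisation.ℓ R (Inverse.from (LetterRealisation.c R) i)

ContainsABAB : ∀ {n k} → (Fin n → Fin k) → Fin k → Fin k → Set
ContainsABAB {n} w a b =
  ∃[ i ] ∃[ j ] ∃[ p ] ∃[ q ]
    (i < j × j < p × p < q × w i ≡ a × w j ≡ b × w p ≡ a × w q ≡ b)

Interlace : ∀ {n k} → (Fin n → Fin k) → Fin k → Fin k → Set
Interlace w a b = ContainsABAB w a b ⊎ ContainsABAB w b a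

Dependent : ∀ {k} → Decoder k → Fin k → Fin k → Set
Dependent D a b =
  (T (arc D a b) × ¬ T (arc D b a)) ⊎ (¬ T (arc D a b) × T (arc D b a))

Independent : ∀ {k} → Decoder k → Fin k → Fin k → Set
Independent D a b = ¬ Dependent D a b

Homogeneous : ∀ {n k} → Graph n → (Fin n → Fin k) → Fin k → Fin k → Set
Homogeneous G ℓ a b =
  (∀ x y → ℓ x ≡ a → ℓ y ≡ b → Adj G x y)
  ⊎ (∀ x y → ℓ x ≡ a → ℓ y ≡ b → ¬ Adj G x y)

{-# OPTIONS --safe #-}
module Submission where

open import Defs
open import Data.Nat using (ℕ)
open import Data.Fin using (Fin; _<_)
open import Data.Fin.Properties using (<-asym; <-cmp)
open import Data.Bool using (T)
open import Data.Empty using (⊥-elim)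
open import Data.Product using (_×_; _,_; ∃-syntax; proj₁)
open import Data.Sum using (_⊎_; inj₁; inj₂; [_,_])
open import Function using (_∘_)
open import Function.Bundles using (_⇔_; Inverse; Injection; Equivalence; mk⇔)
open import Function.Properties.Inverse using (↔⇒↣)
open import Relation.Binary using (tri<; tri≈; tri>)
open import Relation.Binary.PropositionalEquality using (_≡_; _≢_; refl; sym; cong; subst₂)
open import Relation.Nullary using (¬_; yes; no)
open import Relation.Nullary.Decidable using (T?)

-- Everything is a consequence of the adjacency rule between an a-vertex x
-- and a b-vertex y: if both arcs are present, x ~ y always; if none, never;
-- if exactly one, say (a,b), then x ~ y iff x precedes y.  Interlacing
-- provides both an a before a b and a b before an a, so in the last case
-- G[V_a,V_b] contains an edge and a non-edge.

module _ {n k : ℕ} {D : Decoder k} {G : Graph n} (R : LetterRealisation D G) where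
  open LetterRealisation R
  open Equivalence using (to; from)

  pos : Fin n → Fin n
  pos = Inverse.to c

  vertexAt : Fin n → Fin n
  vertexAt = Inverse.from c

  pos-injective : ∀ {x y} → pos x ≡ pos y → x ≡ y
  pos-injective = Injection.injective (↔⇒↣ c)

  vertexAt-monotone : ∀ {i j} → i < j → pos (vertexAt i) < pos (vertexAt j)
  vertexAt-monotone {i} {j} =
    subst₂ _<_ (sym (Inverse.strictlyInverseˡ c i)) (sym (Inverse.strictlyInverseˡ c j))

  adjacent⇔ : ∀ {a b x y} → a ≢ b → ℓ x ≡ a → ℓ y ≡ b →
    Adj G x y ⇔ ((T (arc D a b) × pos x < pos y) ⊎ (T (arc D b a) × pos y < pos x))
  adjacent⇔ {x = x} {y} a≢b refl refl = adjacency x y (a≢b ∘ cong ℓ)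

  both-arcs⇒complete : ∀ {a b} → a ≢ b → T (arc D a b) → T (arc D b a) →
    ∀ x y → ℓ x ≡ a → ℓ y ≡ b → Adj G x y
  both-arcs⇒complete a≢b ab ba x y ℓx ℓy with <-cmp (pos x) (pos y)
  ... | tri< x<y _ _ = from (adjacent⇔ a≢b ℓx ℓy) (inj₁ (ab , x<y))
  ... | tri> _ _ y<x = from (adjacent⇔ a≢b ℓx ℓy) (inj₂ (ba , y<x))
  ... | tri≈ _ x≡y _ with refl ← pos-injective x≡y | refl ← ℓx = ⊥-elim (a≢b ℓy)

  no-arcs⇒edgeless : ∀ {a b} → a ≢ b → ¬ T (arc D a b) → ¬ T (arc D b a) →
    ∀ x y → ℓ x ≡ a → ℓ y ≡ b → ¬ Adj G x y
  no-arcs⇒edgeless a≢b ¬ab ¬ba x y ℓx ℓy =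
    [ ¬ab ∘ proj₁ , ¬ba ∘ proj₁ ] ∘ to (adjacent⇔ a≢b ℓx ℓy)

  independent⇒homogeneous : ∀ {a b} → a ≢ b → Independent D a b → Homogeneous G ℓ a b
  independent⇒homogeneous {a} {b} a≢b ind with T? (arc D a b) | T? (arc D b a)
  ... | yes ab  | yes ba  = inj₁ (both-arcs⇒complete a≢b ab ba)
  ... | no  ¬ab | no  ¬ba = inj₂ (no-arcs⇒edgeless a≢b ¬ab ¬ba)
  ... | yes ab  | no  ¬ba = ⊥-elim (ind (inj₁ (ab , ¬ba)))
  ... | no  ¬ab | yes ba  = ⊥-elim (ind (inj₂ (¬ab , ba)))

  Precedes : Fin k → Fin k → Set
  Precedes a b = ∃[ x ] ∃[ y ] (ℓ x ≡ a × ℓ y ≡ b × pos x < pos y)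

  occurrences⇒precedes : ∀ {a b i j} → i < j → word R i ≡ a → word R j ≡ b → Precedes a b
  occurrences⇒precedes i<j wi wj = _ , _ , wi , wj , vertexAt-monotone i<j

  interlace⇒precedes-both-ways : ∀ {a b} → Interlace (word R) a b → Precedes a b × Precedes b a
  interlace⇒precedes-both-ways (inj₁ (_ , _ , _ , _ , i<j , j<p , _ , wi , wj , wp , _)) =
    occurrences⇒precedes i<j wi wj , occurrences⇒precedes j<p wj wp
  interlace⇒precedes-both-ways (inj₂ (_ , _ , _ , _ , i<j , j<p , _ , wi , wj , wp , _)) =
    occurrences⇒precedes j<p wj wp , occurrences⇒precedes i<j wi wj

  one-arc⇒adjacent⇔precedes : ∀ {a b x y} → a ≢ b → T (arc D a b) → ¬ T (arc D b a) →
    ℓ x ≡ a → ℓ y ≡ b → Adj G x y ⇔ pos x < pos y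
  one-arc⇒adjacent⇔precedes a≢b ab ¬ba ℓx ℓy = mk⇔
    ([ (λ (_ , x<y) → x<y) , (λ (ba , _) → ⊥-elim (¬ba ba)) ] ∘ to (adjacent⇔ a≢b ℓx ℓy))
    (λ x<y → from (adjacent⇔ a≢b ℓx ℓy) (inj₁ (ab , x<y)))

  one-arc⇒inhomogeneous : ∀ {a b} → a ≢ b → T (arc D a b) → ¬ T (arc D b a) →
    Precedes a b → Precedes b a → ¬ Homogeneous G ℓ a b
  one-arc⇒inhomogeneous a≢b ab ¬ba _ (y , x , ℓy , ℓx , y<x) (inj₁ complete) =
    <-asym y<x (to (one-arc⇒adjacent⇔precedes a≢b ab ¬ba ℓx ℓy) (complete x y ℓx ℓy))
  one-arc⇒inhomogeneous a≢b ab ¬ba (x , y , ℓx , ℓy , x<y) _ (inj₂ edgeless) =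
    edgeless x y ℓx ℓy (from (one-arc⇒adjacent⇔precedes a≢b ab ¬ba ℓx ℓy) x<y)

  homogeneous-swap : ∀ {a b} → Homogeneous G ℓ a b → Homogeneous G ℓ b a
  homogeneous-swap (inj₁ complete) = inj₁ λ y x ℓy ℓx → symm G (complete x y ℓx ℓy)
  homogeneous-swap (inj₂ edgeless) = inj₂ λ y x ℓy ℓx → edgeless x y ℓx ℓy ∘ symm G

  dependent⇒inhomogeneous : ∀ {a b} → a ≢ b → Precedes a b → Precedes b a →
    Dependent D a b → ¬ Homogeneous G ℓ a b
  dependent⇒inhomogeneous a≢b ab<ba ba<ab (inj₁ (ab , ¬ba)) =
    one-arc⇒inhomogeneous a≢b ab ¬ba ab<ba ba<ab
  dependent⇒inhomogeneous a≢b ab<ba ba<ab (inj₂ (¬ab , ba)) =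
    one-arc⇒inhomogeneous (a≢b ∘ sym) ba ¬ab ba<ab ab<ba
    ∘ homogeneous-swap

mainTheorem11 : ∀ {n k : ℕ} (D : Decoder k) (G : Graph n)
    (R : LetterRealisation D G) (a b : Fin k) → ¬ (a ≡ b) →
    Interlace (word R) a b →
    (Independent D a b ⇔ Homogeneous G (LetterRealisation.ℓ R) a b)
mainTheorem11 D G R a b a≢b interlace =
  let ab<ba , ba<ab = interlace⇒precedes-both-ways R interlace in
  mk⇔ (independent⇒homogeneous R a≢b)
      (λ hom dep → dependent⇒inhomogeneous R a≢b ab<ba ba<ab dep hom)
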